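{- Let $n \ge 2$, $V=\{1,\dots,n\}$, and let $\tau : V \to \{1,\dots,n\}$ be a bijection. Let $G_n$ be the graph on $V$ obtained by inserting vertices in increasing order of $\tau$, each newly inserted vertex $x$ being joined by an undirected edge to the largest $y<x$ with $\tau(y)<\tau(x)$ (if any) and to the smallest $y>x$ with $\tau(y)<\tau(x)$ (if any); let $N_G(x)$ denote the set of neighbours of $x$ in $G_n$. For $x\in V$ let $r(x)=\min\{y>x : \tau(y)<\tau(x)\}$ (undefined if no such $y$ exists), and call $y \in \{x+1,\dots,n\}$ a right-record of $x$ if $\tau(y) < \min_{z \in \{x+1,\dots,y-1\}} \tau(z)$ (minimum over the empty set being $+\infty$). Then for every $x<n$: the neighbours of $x$ in $\{x+1,\dots,n\}$ are precisely the right-records of $x$ lying in $\{x+1,\dots,r(x)\}$ if $r(x)$ exists, and all right-records of $x$ if $r(x)$ is undefined. Moreover, \[ \max\bigl(N_G(x)\cap\{x+1,\dots,n\}\bigr)=\begin{cases} r(x) & \text{if } r(x) \text{ exists},\\ \arg\min_{y>x}\tau(y) & \text{otherwise.}\end{cases} \]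
   Context: In the paper $\tau$ is a uniformly random permutation of insertion times; the statement is deterministic and holds for every bijection $\tau$. -}

module Defs where

open import Data.Nat using (ℕ)
open import Data.Fin using (Fin; _<_; _≤_)
open import Data.Product using (_×_; ∃)
open import Data.Sum using (_⊎_)
open import Relation.Nullary using (¬_)

-- Vertices V = {1,…,n} are represented 0-indexed as Fin n (order-preserving
-- relabelling); τ-values likewise as Fin n.  Only comparisons matter.

module _ {n : ℕ} (τ : Fin n → Fin n) where

  LeftLink : Fin n → Fin n → Set
  LeftLink x y = (y < x) × (τ y < τ x) × (∀ z → y < z → z < x → ¬ (τ z < τ x))

  RightLink : Fin n → Fin n → Set
  RightLink x y = (x < y) × (τ y < τ x) × (∀ z → x < z → z < y → ¬ (τ z < τ x))

  -- Edges of G_n: when x is inserted (all vertices of smaller τ are already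
  -- present) it is joined to its LeftLink and its RightLink (if any).
  -- Undirected: the edge {x,y} exists iff it was created at the insertion
  -- of x or at the insertion of y.
  Adj : Fin n → Fin n → Set
  Adj x y = LeftLink x y ⊎ RightLink x y ⊎ LeftLink y x ⊎ RightLink y x

  -- r(x) = min { y > x : τ y < τ x };  IsR x r  means "r(x) is defined and equals r"
  IsR : Fin n → Fin n → Set
  IsR x r = (x < r) × (τ r < τ x) × (∀ y → x < y → τ y < τ x → r ≤ y)

  RightRecord : Fin n → Fin n → Set
  RightRecord x y = (x < y) × (∀ z → x < z → z < y → τ y < τ z)

  IsMaxRightNbr : Fin n → Fin n → Set
  IsMaxRightNbr x m = (x < m) × Adj x m × (∀ y → x < y → Adj x y → y ≤ m)

  IsArgMinRight : Fin n → Fin n → Set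
  IsArgMinRight x m = (x < m) × (∀ y → x < y → τ m ≤ τ y)

{-# OPTIONS --safe #-}
module Submission where

-- For y > x the edge {x, y} was created either as the right link of x,
-- which is r(x) itself, or as the left link of y, which happens exactly
-- when τ x < τ y and y is a right-record of x.  Every vertex strictly
-- between x and r(x) has larger τ than x, while nothing beyond r(x) can be
-- linked to x because r(x) lies in between with τ r(x) < τ x.  When r(x)
-- is undefined all vertices to the right of x have larger τ, and the
-- rightmost right-record is the argmin of τ to the right of x.

open import Defs
open import Data.Nat using (ℕ)
import Data.Nat.Properties as ℕ
open import Data.Fin using (Fin; toℕ)
open import Data.Fin.Properties using (<-asym; <-trans; <⇒≢; ≤∧≢⇒<; toℕ-injective)
open import Data.Fin.Induction using (<-wellFounded)
open import Data.Product using (_×_; ∃; _,_; proj₂)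
open import Data.Sum using (_⊎_; inj₁; inj₂)
open import Data.Empty using (⊥; ⊥-elim)
open import Function.Base using (_∘_)
open import Function.Definitions using (Injective; Bijective)
open import Function.Bundles using (_⇔_; mk⇔)
open import Induction.WellFounded using (module All)
open import Relation.Nullary using (¬_)
open import Relation.Unary using (Pred)
open import Relation.Binary.PropositionalEquality using (_≡_; _≢_; sym)

module _ {n : ℕ} where
  open Data.Fin using (_<_; _≤_)

  noLeast⇒empty : ∀ {ℓ} {P : Pred (Fin n) ℓ} →
                  (∀ y → P y → (∀ {w} → w < y → ¬ P w) → ⊥) → ∀ y → ¬ P y
  noLeast⇒empty {P = P} noLeast =
    All.wfRec <-wellFounded _ (λ y → ¬ P y) (λ y below Py → noLeast y Py below)

  module _ {τ : Fin n → Fin n} {x : Fin n} where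

    Adj⇒RightLink⊎LeftLink : ∀ {y} → x < y → Adj τ x y → RightLink τ x y ⊎ LeftLink τ y x
    Adj⇒RightLink⊎LeftLink x<y (inj₁ (y<x , _))                = ⊥-elim (<-asym x<y y<x)
    Adj⇒RightLink⊎LeftLink x<y (inj₂ (inj₁ link))              = inj₁ link
    Adj⇒RightLink⊎LeftLink x<y (inj₂ (inj₂ (inj₁ link)))       = inj₂ link
    Adj⇒RightLink⊎LeftLink x<y (inj₂ (inj₂ (inj₂ (y<x , _)))) = ⊥-elim (<-asym x<y y<x)

    RightLink⇒IsR : ∀ {y} → RightLink τ x y → IsR τ x y
    RightLink⇒IsR (x<y , τy<τx , none) =
      x<y , τy<τx , λ w x<w τw<τx → ℕ.≮⇒≥ (λ w<y → none w x<w w<y τw<τx)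

    IsR⇒RightLink : ∀ {r} → IsR τ x r → RightLink τ x r
    IsR⇒RightLink (x<r , τr<τx , least) =
      x<r , τr<τx , λ z x<z z<r τz<τx → ℕ.<⇒≱ z<r (least z x<z τz<τx)

    RightLink⇒RightRecord : ∀ {y} → RightLink τ x y → RightRecord τ x y
    RightLink⇒RightRecord (x<y , τy<τx , none) =
      x<y , λ z x<z z<y → ℕ.<-≤-trans τy<τx (ℕ.≮⇒≥ (none z x<z z<y))

    RightRecord⇒LeftLink : ∀ {y} → τ x < τ y → RightRecord τ x y → LeftLink τ y x
    RightRecord⇒LeftLink τx<τy (x<y , rec) =
      x<y , τx<τy , λ z x<z z<y τz<τy → <-asym τz<τy (rec z x<z z<y)

    Adj⇒≤r : ∀ {r y} → IsR τ x r → x < y → Adj τ x y → y ≤ r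
    Adj⇒≤r (x<r , τr<τx , _) x<y adj with Adj⇒RightLink⊎LeftLink x<y adj
    ... | inj₁ (_ , _ , none)     = ℕ.≮⇒≥ (λ r<y → none _ x<r r<y τr<τx)
    ... | inj₂ (_ , τx<τy , none) = ℕ.≮⇒≥ (λ r<y → none _ x<r r<y (<-trans τr<τx τx<τy))

    IsR⇒IsMaxRightNbr : ∀ {r} → IsR τ x r → IsMaxRightNbr τ x r
    IsR⇒IsMaxRightNbr isR@(x<r , _) =
      x<r , inj₂ (inj₁ (IsR⇒RightLink isR)) , λ y x<y → Adj⇒≤r isR x<y

    module _ (τ-injective : Injective _≡_ _≡_ τ) where

      τ-≮⇒> : ∀ {y z} → y ≢ z → ¬ (τ y < τ z) → τ z < τ y
      τ-≮⇒> y≢z τy≮τz = ≤∧≢⇒< (ℕ.≮⇒≥ τy≮τz) (λ τz≡τy → y≢z (sym (τ-injective τz≡τy)))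

      LeftLink⇒RightRecord : ∀ {y} → LeftLink τ y x → RightRecord τ x y
      LeftLink⇒RightRecord (x<y , _ , none) =
        x<y , λ z x<z z<y → τ-≮⇒> (<⇒≢ z<y) (none z x<z z<y)

      Adj⇒RightRecord : ∀ {y} → x < y → Adj τ x y → RightRecord τ x y
      Adj⇒RightRecord x<y adj with Adj⇒RightLink⊎LeftLink x<y adj
      ... | inj₁ link = RightLink⇒RightRecord link
      ... | inj₂ link = LeftLink⇒RightRecord link

      RightRecord⇒Adj : ∀ {y} → τ x < τ y → RightRecord τ x y → Adj τ x y
      RightRecord⇒Adj τx<τy rec = inj₂ (inj₂ (inj₁ (RightRecord⇒LeftLink τx<τy rec)))

      IsR⇒τ-below-r : ∀ {r y} → IsR τ x r → x < y → y < r → τ x < τ y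
      IsR⇒τ-below-r (_ , _ , least) x<y y<r =
        τ-≮⇒> (<⇒≢ x<y ∘ sym) (λ τy<τx → ℕ.<⇒≱ y<r (least _ x<y τy<τx))

      ¬IsR⇒τ-right : ¬ ∃ (IsR τ x) → ∀ {y} → x < y → τ x < τ y
      ¬IsR⇒τ-right noR {y} x<y =
        τ-≮⇒> (<⇒≢ x<y ∘ sym) (λ τy<τx → noSmallerRight y (x<y , τy<τx))
        where
        -- A least y > x with τ y < τ x would be r(x).
        noSmallerRight : ∀ y → ¬ (x < y × τ y < τ x)
        noSmallerRight = noLeast⇒empty λ y (x<y , τy<τx) below →
          noR (y , x<y , τy<τx , λ w x<w τw<τx → ℕ.≮⇒≥ (λ w<y → below w<y (x<w , τw<τx)))

      IsR⇒Adj⇔RightRecord≤r : ∀ {r y} → IsR τ x r → x < y →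
                              Adj τ x y ⇔ (RightRecord τ x y × y ≤ r)
      IsR⇒Adj⇔RightRecord≤r {r} {y} isR x<y =
        mk⇔ (λ adj → Adj⇒RightRecord x<y adj , Adj⇒≤r isR x<y adj) adjacent
        where
        adjacent : RightRecord τ x y × y ≤ r → Adj τ x y
        adjacent (rec , y≤r) with ℕ.m≤n⇒m<n∨m≡n y≤r
        ... | inj₁ y<r = RightRecord⇒Adj (IsR⇒τ-below-r isR x<y y<r) rec
        ... | inj₂ y≡r rewrite toℕ-injective y≡r = inj₂ (inj₁ (IsR⇒RightLink isR))

      ¬IsR⇒Adj⇔RightRecord : ¬ ∃ (IsR τ x) → ∀ {y} → x < y → Adj τ x y ⇔ RightRecord τ x y
      ¬IsR⇒Adj⇔RightRecord noR x<y =
        mk⇔ (Adj⇒RightRecord x<y) (RightRecord⇒Adj (¬IsR⇒τ-right noR x<y))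

      ¬IsR⇒ArgMin⇒IsMaxRightNbr : ¬ ∃ (IsR τ x) → ∀ {m} →
                                  IsArgMinRight τ x m → IsMaxRightNbr τ x m
      ¬IsR⇒ArgMin⇒IsMaxRightNbr noR {m} (x<m , minimal) = x<m , adjacent , maximal
        where
        adjacent : Adj τ x m
        adjacent = RightRecord⇒Adj (¬IsR⇒τ-right noR x<m)
          (x<m , λ z x<z z<m → ≤∧≢⇒< (minimal z x<z) (<⇒≢ z<m ∘ sym ∘ τ-injective))
        maximal : ∀ y → x < y → Adj τ x y → y ≤ m
        maximal y x<y adj = ℕ.≮⇒≥ (λ m<y →
          ℕ.<⇒≱ (proj₂ (Adj⇒RightRecord x<y adj) _ x<m m<y) (minimal y x<y))

-- Imported only now: the order on Fin is used unqualified above.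
open import Data.Nat using (suc; _≤_)

lemma4p2 : (n : ℕ) → 2 ≤ n → (τ : Fin n → Fin n) → Bijective _≡_ _≡_ τ →
    (x : Fin n) → suc (toℕ x) Data.Nat.< n →
      ((r : Fin n) → IsR τ x r →
          ((y : Fin n) → x Data.Fin.< y →
             (Adj τ x y ⇔ (RightRecord τ x y × y Data.Fin.≤ r)))
        × IsMaxRightNbr τ x r)
    × (¬ (∃ λ r → IsR τ x r) →
          ((y : Fin n) → x Data.Fin.< y → (Adj τ x y ⇔ RightRecord τ x y))
        × ((m : Fin n) → IsArgMinRight τ x m → IsMaxRightNbr τ x m))
lemma4p2 n _ τ (τ-injective , _) x _ =
  (λ r isR → (λ y → IsR⇒Adj⇔RightRecord≤r τ-injective isR) , IsR⇒IsMaxRightNbr isR) ,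
  (λ noR → (λ y → ¬IsR⇒Adj⇔RightRecord τ-injective noR) ,
           (λ m → ¬IsR⇒ArgMin⇒IsMaxRightNbr τ-injective noR))
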